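{- Let $G=(V,E)$ be a connected graph with $n$ vertices satisfying $\mathrm{AC}(G)=1$, and let $U\subseteq V$ be the set of vertices $v$ with $\deg(v)\ge n/2$. Then for every $W\subseteq V\setminus U$ there is a matching in $G$ of size $|W|-1$ between $U$ and $W$, i.e., a set of $|W|-1$ pairwise vertex-disjoint edges of $G$ each having one endpoint in $U$ and the other in $W$.
   Context: Acquaintance time: for a connected graph, place one agent on each vertex. Two agents are acquainted once they occupy the two endpoints of a common edge at some time (including the initial placement). In each round one chooses a matching (set of pairwise vertex-disjoint edges, not necessarily maximal), and for every edge of it the two agents on its endpoints swap places. A strategy for acquaintance is a sequence of matchings after which every pair of agents has been acquainted; $\mathrm{AC}(G)$ is the minimum number of rounds in such a strategy. -}

module Defs where

open import Data.Nat using (ℕ; _≤_; _*_; _∸_)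
open import Data.Fin using (Fin; _≟_)
open import Data.Fin.Subset using (Subset; _∈_; ∣_∣)
open import Data.List using (List; []; _∷_; length; filter; take; concatMap)
open import Data.List.Base using (allFin)
open import Data.List.Relation.Unary.All using (All)
open import Data.List.Relation.Unary.Unique.Propositional using (Unique)
open import Data.Product using (_×_; _,_; Σ; ∃; ∃-syntax)
open import Relation.Nullary using (¬_; Dec; yes; no)
open import Relation.Unary using (Decidable)
open import Relation.Binary.PropositionalEquality using (_≡_)

record Graph (n : ℕ) : Set₁ where
  field
    _~_    : Fin n → Fin n → Set
    ~-dec  : ∀ u v → Dec (u ~ v)
    ~-sym  : ∀ {u v} → u ~ v → v ~ u
    ~-irr  : ∀ {u} → ¬ (u ~ u)

module _ {n : ℕ} (G : Graph n) where
  open Graph G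

  data Walk : Fin n → Fin n → Set where
    here : ∀ {u} → Walk u u
    step : ∀ {u v w} → u ~ v → Walk v w → Walk u w

  Connected : Set
  Connected = ∀ u v → Walk u v

  deg : Fin n → ℕ
  deg v = length (filter (~-dec v) (allFin n))

  endpoints : List (Fin n × Fin n) → List (Fin n)
  endpoints = concatMap (λ { (a , b) → a ∷ b ∷ [] })

  IsMatching : List (Fin n × Fin n) → Set
  IsMatching M = All (λ { (a , b) → a ~ b }) M × Unique (endpoints M)

  Matching : Set
  Matching = Σ (List (Fin n × Fin n)) IsMatching

  -- the permutation of vertices induced by swapping along the edges of a matching
  swapL : List (Fin n × Fin n) → Fin n → Fin n
  swapL [] v = v
  swapL ((a , b) ∷ M) v with v ≟ a
  ... | yes _ = b
  ... | no _ with v ≟ b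
  ...   | yes _ = a
  ...   | no _ = swapL M v

  -- position of agent x (initially on vertex x) after performing the rounds in order
  position : List Matching → Fin n → Fin n
  position [] x = x
  position ((M , _) ∷ Ms) x = position Ms (swapL M x)

  -- agents x and y are acquainted during the strategy Ms:
  -- at some time t ∈ {0,…,length Ms} they occupy adjacent vertices
  Acquainted : List Matching → Fin n → Fin n → Set
  Acquainted Ms x y = ∃[ t ] (t ≤ length Ms × (position (take t Ms) x ~ position (take t Ms) y))

  IsStrategy : List Matching → Set
  IsStrategy Ms = ∀ x y → ¬ (x ≡ y) → Acquainted Ms x y

  ACis : ℕ → Set
  ACis k = (∃[ Ms ] (IsStrategy Ms × length Ms ≡ k))
         × (∀ Ms → IsStrategy Ms → k ≤ length Ms)

  -- U = vertices of degree ≥ n/2, i.e. 2·deg v ≥ n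
  InU : Fin n → Set
  InU v = n ≤ 2 * deg v

  MatchingBetween : (Fin n → Set) → Subset n → ℕ → Set
  MatchingBetween U W s =
    ∃[ M ] (IsMatching M × length M ≡ s
            × All (λ { (u , w) → U u × w ∈ W }) M)

module Submission where

-- If AC(G) = 1, an optimal strategy is a single matching M; let σ be the
-- involution swapping the endpoints of each edge of M.  Distinct agents x, y
-- meet at time 0 (x ~ y) or at time 1 (σx ~ σy).  Hence:
--  * Degree bound: if x ≠ y, x ~ y and σx ~ σy then deg x + deg σx ≥ n, since
--    every z ≠ x satisfies x ~ z or σx ~ σz, z = y satisfies both, and σ is a
--    permutation, so the second count is deg σx.
--  * At most one vertex x has both x and σx outside U (a second one yields a
--    pair violating the degree bound).
--  * For W ⊆ V ∖ U all but at most one w ∈ W have σw ∈ U; then σw ≠ w, so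
--    (σw , w) is an edge, and these edges are disjoint because σ is injective
--    and σw ∉ W.  Any |W| - 1 of them form the required matching.

open import Defs
open import Data.Nat using (ℕ; zero; suc; _+_; _*_; _∸_; _≤_; _<_; z≤n; s≤s; _≤?_)
open import Data.Nat.Properties
  using (≤-refl; ≤-reflexive; ≤-trans; +-mono-≤; m≤n+m; +-identityʳ; +-cancelʳ-≤; <⇒≱;
         *-cancelˡ-≤; ≰⇒>; ∸-monoˡ-≤; m≤n⇒m⊓n≡m; +-0-commutativeMonoid; module ≤-Reasoning)
open import Data.Nat.Tactic.RingSolver using (solve-∀)
open import Data.Bool using (if_then_else_)
open import Data.Fin using (Fin; zero; suc; _≟_)
open import Data.Fin.Subset using (Subset; _∈_; ∣_∣; inside; outside)
open import Data.Fin.Subset.Properties using (_∈?_)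
open import Data.Fin.Permutation using (permutation)
open import Data.Vec using ([]; _∷_)
open import Data.List using (List; []; _∷_; length; filter; take; map; tabulate; allFin)
open import Data.List.Properties using (filter-all; length-map; length-take)
open import Data.List.Relation.Unary.All as All using (All; []; _∷_)
import Data.List.Relation.Unary.All.Properties as All
open import Data.List.Relation.Unary.Any using (here; there)
open import Data.List.Relation.Unary.AllPairs using ([]; _∷_)
open import Data.List.Relation.Unary.Unique.Propositional using (Unique)
import Data.List.Relation.Unary.Unique.Propositional.Properties as Unique
open import Data.List.Membership.Propositional renaming (_∈_ to _∈ₗ_)
open import Data.List.Membership.Propositional.Properties using (∈-filter⁻)
open import Data.Product using (_×_; _,_; proj₁; proj₂)
open import Data.Sum using (_⊎_; inj₁; inj₂)
open import Data.Empty using (⊥; ⊥-elim)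
open import Relation.Nullary using (Dec; yes; no; does; ¬_)
open import Relation.Binary.PropositionalEquality
  using (_≡_; _≢_; refl; sym; trans; cong; cong₂; subst; subst₂; module ≡-Reasoning)
import Algebra.Properties.CommutativeMonoid.Sum as CommutativeMonoidSum
open CommutativeMonoidSum +-0-commutativeMonoid
  using (sum; ∑-distrib-+; sum-permute; sum-replicate-zero)

χ : ∀ {p} {P : Set p} → Dec P → ℕ
χ d = if does d then 1 else 0

sum-mono : ∀ {n} (f g : Fin n → ℕ) → (∀ i → f i ≤ g i) → sum f ≤ sum g
sum-mono {zero}  f g f≤g = z≤n
sum-mono {suc n} f g f≤g =
  +-mono-≤ (f≤g zero) (sum-mono (λ i → f (suc i)) (λ i → g (suc i)) (λ i → f≤g (suc i)))

sum-one : ∀ n → sum {n} (λ _ → 1) ≡ n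
sum-one zero    = refl
sum-one (suc n) = cong suc (sum-one n)

sum-point : ∀ {n} (y : Fin n) → sum (λ z → χ (z ≟ y)) ≡ 1
sum-point {suc n} zero    = cong suc (sum-replicate-zero n)
sum-point {suc n} (suc y) = sum-point y

length-filter-tabulate : ∀ {a p} {A : Set a} {P : A → Set p} (P? : ∀ x → Dec (P x))
  {n} (f : Fin n → A) → length (filter P? (tabulate f)) ≡ sum (λ i → χ (P? (f i)))
length-filter-tabulate P? {zero}  f = refl
length-filter-tabulate P? {suc n} f with P? (f zero)
... | yes _ = cong suc (length-filter-tabulate P? (λ i → f (suc i)))
... | no _  = length-filter-tabulate P? (λ i → f (suc i))

card≡sum : ∀ {n} (W : Subset n) → ∣ W ∣ ≡ sum (λ i → χ (i ∈? W))
card≡sum []            = refl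
card≡sum (inside ∷ W)  = cong suc (card≡sum W)
card≡sum (outside ∷ W) = card≡sum W

members : ∀ {n} → Subset n → List (Fin n)
members {n} W = filter (_∈? W) (allFin n)

length-members : ∀ {n} (W : Subset n) → length (members W) ≡ ∣ W ∣
length-members W = trans (length-filter-tabulate (_∈? W) (λ i → i)) (sym (card≡sum W))

length≤1+filter : ∀ {a p} {A : Set a} {P : A → Set p} (P? : ∀ x → Dec (P x))
  (xs : List A) → Unique xs →
  (∀ u v → u ∈ₗ xs → v ∈ₗ xs → u ≢ v → ¬ P u → ¬ P v → ⊥) →
  length xs ≤ suc (length (filter P? xs))
length≤1+filter P? [] _ _ = z≤n
length≤1+filter {P = P} P? (x ∷ xs) (x∉xs ∷ unique) atMostOne with P? x
... | yes _  = s≤s (length≤1+filter P? xs unique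
                     (λ u v u∈ v∈ → atMostOne u v (there u∈) (there v∈)))
... | no ¬Px = s≤s (≤-reflexive (sym (cong length (filter-all P? restSatisfies))))
  where
  -- x is the exceptional element, so every other element satisfies P.
  restSatisfies : All P xs
  restSatisfies = All.tabulate λ {v} v∈ → satisfies v v∈ (P? v)
    where
    satisfies : ∀ v → v ∈ₗ xs → Dec (P v) → P v
    satisfies v v∈ (yes Pv) = Pv
    satisfies v v∈ (no ¬Pv) =
      ⊥-elim (atMostOne x v (here refl) (there v∈) (All.lookup x∉xs v∈) ¬Px ¬Pv)

halves-sum : ∀ n a b → 2 * a < n → 2 * b < n → a + b < n
halves-sum n a b 2a<n 2b<n = *-cancelˡ-≤ 2 (begin
  2 * suc (a + b)           ≡⟨ doubling a b ⟩
  suc (2 * a) + suc (2 * b) ≤⟨ +-mono-≤ 2a<n 2b<n ⟩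
  n + n                     ≡⟨ sym (doubling′ n) ⟩
  2 * n                     ∎)
  where
  open ≤-Reasoning
  doubling : ∀ a b → 2 * suc (a + b) ≡ suc (2 * a) + suc (2 * b)
  doubling = solve-∀
  doubling′ : ∀ n → 2 * n ≡ n + n
  doubling′ = solve-∀

module Swap {n : ℕ} (G : Graph n) where
  open Graph G

  swap-first : ∀ a b M → swapL G ((a , b) ∷ M) a ≡ b
  swap-first a b M with a ≟ a
  ... | yes _   = refl
  ... | no a≢a  = ⊥-elim (a≢a refl)

  swap-second : ∀ a b M → a ≢ b → swapL G ((a , b) ∷ M) b ≡ a
  swap-second a b M a≢b with b ≟ a
  ... | yes b≡a = ⊥-elim (a≢b (sym b≡a))
  ... | no _ with b ≟ b
  ...   | yes _  = refl
  ...   | no b≢b = ⊥-elim (b≢b refl)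

  swap-elsewhere : ∀ a b M v → v ≢ a → v ≢ b → swapL G ((a , b) ∷ M) v ≡ swapL G M v
  swap-elsewhere a b M v v≢a v≢b with v ≟ a
  ... | yes v≡a = ⊥-elim (v≢a v≡a)
  ... | no _ with v ≟ b
  ...   | yes v≡b = ⊥-elim (v≢b v≡b)
  ...   | no _    = refl

  swap-fixes-or-lands : ∀ M v → swapL G M v ≡ v ⊎ swapL G M v ∈ₗ endpoints G M
  swap-fixes-or-lands [] v = inj₁ refl
  swap-fixes-or-lands ((a , b) ∷ M) v with v ≟ a
  ... | yes _ = inj₂ (there (here refl))
  ... | no _ with v ≟ b
  ...   | yes _ = inj₂ (here refl)
  ...   | no _ with swap-fixes-or-lands M v
  ...     | inj₁ fixed = inj₁ fixed
  ...     | inj₂ lands = inj₂ (there (there lands))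

  swap-avoids : ∀ M {c v} → All (c ≢_) (endpoints G M) → v ≢ c → swapL G M v ≢ c
  swap-avoids M {v = v} c∉M v≢c with swap-fixes-or-lands M v
  ... | inj₁ fixed = λ w≡c → v≢c (trans (sym fixed) w≡c)
  ... | inj₂ lands = λ w≡c → All.lookup c∉M lands (sym w≡c)

  -- The swap of a matching is an involution.  The case split on the position
  -- of v is passed as arguments so that it does not interact with swapL's own
  -- case analysis.
  swap-involutive : ∀ M → IsMatching G M → ∀ v → swapL G M (swapL G M v) ≡ v
  swap-involutive-cons : ∀ a b M → IsMatching G ((a , b) ∷ M) → ∀ v → Dec (v ≡ a) → Dec (v ≡ b) →
    swapL G ((a , b) ∷ M) (swapL G ((a , b) ∷ M) v) ≡ v

  swap-involutive [] _ v = refl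
  swap-involutive ((a , b) ∷ M) matching v = swap-involutive-cons a b M matching v (v ≟ a) (v ≟ b)

  swap-involutive-cons a b M (_ , (a≢b ∷ _) ∷ _) .a (yes refl) _ =
    trans (cong (swapL G ((a , b) ∷ M)) (swap-first a b M)) (swap-second a b M a≢b)
  swap-involutive-cons a b M (_ , (a≢b ∷ _) ∷ _) .b (no _) (yes refl) =
    trans (cong (swapL G ((a , b) ∷ M)) (swap-second a b M a≢b)) (swap-first a b M)
  swap-involutive-cons a b M (_ ∷ edges , (_ ∷ a∉M) ∷ (b∉M ∷ unique)) v (no v≢a) (no v≢b) = begin
    swapL G ((a , b) ∷ M) (swapL G ((a , b) ∷ M) v)
      ≡⟨ cong (swapL G ((a , b) ∷ M)) (swap-elsewhere a b M v v≢a v≢b) ⟩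
    swapL G ((a , b) ∷ M) (swapL G M v)
      ≡⟨ swap-elsewhere a b M (swapL G M v) (swap-avoids M a∉M v≢a) (swap-avoids M b∉M v≢b) ⟩
    swapL G M (swapL G M v)
      ≡⟨ swap-involutive M (edges , unique) v ⟩
    v ∎
    where open ≡-Reasoning

  swap-along-edge : ∀ M → IsMatching G M → ∀ v → swapL G M v ≡ v ⊎ v ~ swapL G M v
  swap-along-edge-cons : ∀ a b M → IsMatching G ((a , b) ∷ M) → ∀ v → Dec (v ≡ a) → Dec (v ≡ b) →
    swapL G ((a , b) ∷ M) v ≡ v ⊎ v ~ swapL G ((a , b) ∷ M) v

  swap-along-edge [] _ v = inj₁ refl
  swap-along-edge ((a , b) ∷ M) matching v = swap-along-edge-cons a b M matching v (v ≟ a) (v ≟ b)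

  swap-along-edge-cons a b M (a~b ∷ _ , _) .a (yes refl) _ =
    inj₂ (subst (a ~_) (sym (swap-first a b M)) a~b)
  swap-along-edge-cons a b M (a~b ∷ _ , (a≢b ∷ _) ∷ _) .b (no _) (yes refl) =
    inj₂ (subst (b ~_) (sym (swap-second a b M a≢b)) (~-sym a~b))
  swap-along-edge-cons a b M (_ ∷ edges , _ ∷ (_ ∷ unique)) v (no v≢a) (no v≢b)
    with swap-along-edge M (edges , unique) v
  ... | inj₁ fixed = inj₁ (trans (swap-elsewhere a b M v v≢a v≢b) fixed)
  ... | inj₂ moved = inj₂ (subst (v ~_) (sym (swap-elsewhere a b M v v≢a v≢b)) moved)

one-round-covers : ∀ {n} (G : Graph n) (M : List (Fin n × Fin n)) (matching : IsMatching G M) →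
  IsStrategy G ((M , matching) ∷ []) →
  ∀ x y → x ≢ y → Graph._~_ G x y ⊎ Graph._~_ G (swapL G M x) (swapL G M y)
one-round-covers G M matching strategy x y x≢y with strategy x y x≢y
... | zero , _ , adjacent           = inj₁ adjacent
... | suc zero , _ , adjacent       = inj₂ adjacent
... | suc (suc _) , s≤s () , _

module CoveringInvolution {n : ℕ} (G : Graph n) (σ : Fin n → Fin n)
  (σ-involutive : ∀ v → σ (σ v) ≡ v)
  (σ-along-edge : ∀ v → σ v ≡ v ⊎ Graph._~_ G v (σ v))
  (σ-covers : ∀ x y → x ≢ y → Graph._~_ G x y ⊎ Graph._~_ G (σ x) (σ y)) where
  open Graph G

  σ-injective : ∀ {u v} → σ u ≡ σ v → u ≡ v
  σ-injective {u} {v} σu≡σv = trans (sym (σ-involutive u)) (trans (cong σ σu≡σv) (σ-involutive v))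

  deg≡sum : ∀ v → deg G v ≡ sum (λ z → χ (~-dec v z))
  deg≡sum v = length-filter-tabulate (~-dec v) (λ i → i)

  deg≡sum∘σ : ∀ v → deg G v ≡ sum (λ z → χ (~-dec v (σ z)))
  deg≡sum∘σ v = trans (deg≡sum v)
    (sum-permute (λ z → χ (~-dec v z)) (permutation σ σ σ-involutive σ-involutive))

  module _ (x y : Fin n) (y≢x : y ≢ x) (x~y : x ~ y) (σx~σy : σ x ~ σ y) where
    count : Fin n → ℕ
    count z = χ (~-dec x z) + χ (~-dec (σ x) (σ z))

    y-counted-twice : 2 ≤ count y
    y-counted-twice with ~-dec x y | ~-dec (σ x) (σ y)
    ... | yes _ | yes _    = ≤-refl
    ... | no ¬x~y | _      = ⊥-elim (¬x~y x~y)
    ... | yes _ | no ¬σx~σy = ⊥-elim (¬σx~σy σx~σy)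

    others-counted : ∀ z → z ≢ x → 1 ≤ count z
    others-counted z z≢x with σ-covers x z (λ x≡z → z≢x (sym x≡z)) | ~-dec x z | ~-dec (σ x) (σ z)
    ... | _ | yes _ | _               = s≤s z≤n
    ... | _ | no _ | yes _            = s≤s z≤n
    ... | inj₁ x~z | no ¬x~z | no _   = ⊥-elim (¬x~z x~z)
    ... | inj₂ σx~σz | no _ | no ¬σx~σz = ⊥-elim (¬σx~σz σx~σz)

    -- Pointwise form of "count ≥ 1 off x, and ≥ 2 at y", ready for summation.
    count-pointwise : ∀ z → 1 + χ (z ≟ y) ≤ count z + χ (z ≟ x)
    count-pointwise z with z ≟ x | z ≟ y
    ... | yes refl | yes y≡x = ⊥-elim (y≢x (sym y≡x))
    ... | yes refl | no _    = m≤n+m 1 (count z)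
    ... | no z≢x | yes refl  = ≤-trans y-counted-twice (≤-reflexive (sym (+-identityʳ (count y))))
    ... | no z≢x | no _      = ≤-trans (others-counted z z≢x) (≤-reflexive (sym (+-identityʳ (count z))))

    degree-bound : n ≤ deg G x + deg G (σ x)
    degree-bound = +-cancelʳ-≤ 1 _ _ (subst₂ _≤_ sum-left sum-right
                     (sum-mono _ _ count-pointwise))
      where
      open ≡-Reasoning
      sum-left : sum (λ z → 1 + χ (z ≟ y)) ≡ n + 1
      sum-left = trans (∑-distrib-+ (λ _ → 1) (λ z → χ (z ≟ y)))
                       (cong₂ _+_ (sum-one n) (sum-point y))
      sum-right : sum (λ z → count z + χ (z ≟ x)) ≡ (deg G x + deg G (σ x)) + 1
      sum-right = begin
        sum (λ z → count z + χ (z ≟ x))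
          ≡⟨ ∑-distrib-+ count (λ z → χ (z ≟ x)) ⟩
        sum count + sum (λ z → χ (z ≟ x))
          ≡⟨ cong₂ _+_ (∑-distrib-+ (λ z → χ (~-dec x z)) (λ z → χ (~-dec (σ x) (σ z))))
                       (sum-point x) ⟩
        (sum (λ z → χ (~-dec x z)) + sum (λ z → χ (~-dec (σ x) (σ z)))) + 1
          ≡⟨ cong (_+ 1) (cong₂ _+_ (sym (deg≡sum x)) (sym (deg≡sum∘σ (σ x)))) ⟩
        (deg G x + deg G (σ x)) + 1 ∎

  Low : Fin n → Set
  Low v = ¬ InU G v

  not-both-low : ∀ x y → y ≢ x → x ~ y → σ x ~ σ y → Low x → Low (σ x) → ⊥
  not-both-low x y y≢x x~y σx~σy low-x low-σx =
    <⇒≱ (halves-sum n (deg G x) (deg G (σ x)) (≰⇒> low-x) (≰⇒> low-σx))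
        (degree-bound x y y≢x x~y σx~σy)

  low-orbit-unique : ∀ x y → x ≢ y → Low x → Low (σ x) → Low y → Low (σ y) → ⊥
  low-orbit-unique x y x≢y low-x low-σx low-y low-σy with σ-along-edge x | σ-along-edge y
  ... | inj₂ x~σx | _ =
    not-both-low x (σ x) (λ σx≡x → ~-irr (subst (x ~_) σx≡x x~σx)) x~σx
      (subst (σ x ~_) (sym (σ-involutive x)) (~-sym x~σx)) low-x low-σx
  ... | inj₁ _ | inj₂ y~σy =
    not-both-low y (σ y) (λ σy≡y → ~-irr (subst (y ~_) σy≡y y~σy)) y~σy
      (subst (σ y ~_) (sym (σ-involutive y)) (~-sym y~σy)) low-y low-σy
  ... | inj₁ σx≡x | inj₁ σy≡y =
    not-both-low x y (λ y≡x → x≢y (sym y≡x)) x~y (subst₂ _~_ (sym σx≡x) (sym σy≡y) x~y)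
      low-x low-σx
    where
    x~y : x ~ y
    x~y with σ-covers x y x≢y
    ... | inj₁ x~y   = x~y
    ... | inj₂ σx~σy = subst₂ _~_ σx≡x σy≡y σx~σy

  InU? : ∀ v → Dec (InU G v)
  InU? v = n ≤? 2 * deg G v

  module Construction (W : Subset n) (W-low : ∀ v → v ∈ W → Low v) where
    Good : Fin n → Set
    Good w = w ∈ W × InU G (σ w)

    edge : Fin n → Fin n × Fin n
    edge w = (σ w , w)

    -- The partner of a good vertex is in U, hence outside W.
    partner-outside-W : ∀ {u v} → Good u → v ∈ W → σ u ≢ v
    partner-outside-W (_ , σu∈U) v∈W σu≡v = W-low _ v∈W (subst (InU G) σu≡v σu∈U)

    good-edge : ∀ {w} → Good w → σ w ~ w
    good-edge {w} good with σ-along-edge w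
    ... | inj₁ σw≡w = ⊥-elim (partner-outside-W good (proj₁ good) σw≡w)
    ... | inj₂ w~σw = ~-sym w~σw

    all-endpoints : ∀ {P : Fin n → Set} L → All (λ v → P (σ v) × P v) L →
      All P (endpoints G (map edge L))
    all-endpoints []      []                 = []
    all-endpoints (_ ∷ L) ((Pσv , Pv) ∷ rest) = Pσv ∷ Pv ∷ all-endpoints L rest

    edges-disjoint : ∀ L → Unique L → All Good L → Unique (endpoints G (map edge L))
    edges-disjoint [] _ _ = []
    edges-disjoint (w ∷ L) (w∉L ∷ unique) (good-w ∷ good-L) =
      (partner-outside-W good-w (proj₁ good-w) ∷ all-endpoints L (All.zipWith σw-avoids (w∉L , good-L)))
      ∷ (all-endpoints L (All.zipWith w-avoids (w∉L , good-L)) ∷ edges-disjoint L unique good-L)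
      where
      σw-avoids : ∀ {v} → w ≢ v × Good v → σ w ≢ σ v × σ w ≢ v
      σw-avoids (w≢v , good-v) = (λ σw≡σv → w≢v (σ-injective σw≡σv)) , partner-outside-W good-w (proj₁ good-v)
      w-avoids : ∀ {v} → w ≢ v × Good v → w ≢ σ v × w ≢ v
      w-avoids (w≢v , good-v) = (λ w≡σv → partner-outside-W good-v (proj₁ good-w) (sym w≡σv)) , w≢v

    matching-of-good : ∀ L → Unique L → All Good L → MatchingBetween G (InU G) W (length L)
    matching-of-good L unique good =
      map edge L ,
      (All.map⁺ (All.map good-edge good) , edges-disjoint L unique good) ,
      length-map edge L ,
      All.map⁺ (All.map (λ (w∈W , σw∈U) → σw∈U , w∈W) good)

    good-members : List (Fin n)
    good-members = filter (λ w → InU? (σ w)) (members W)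

    members-unique : Unique (members W)
    members-unique = Unique.filter⁺ (_∈? W) (Unique.allFin⁺ n)

    member-in-W : ∀ {w} → w ∈ₗ members W → w ∈ W
    member-in-W w∈ = proj₂ (∈-filter⁻ (_∈? W) {xs = allFin n} w∈)

    good-members-good : All Good good-members
    good-members-good = All.tabulate λ w∈ →
      let (w∈members , σw∈U) = ∈-filter⁻ (λ w → InU? (σ w)) {xs = members W} w∈
      in member-in-W w∈members , σw∈U

    many-good-members : ∣ W ∣ ≤ suc (length good-members)
    many-good-members = subst (_≤ suc (length good-members)) (length-members W)
      (length≤1+filter (λ w → InU? (σ w)) (members W) members-unique
        λ u v u∈ v∈ u≢v low-σu low-σv →
          low-orbit-unique u v u≢v (W-low u (member-in-W u∈)) low-σu (W-low v (member-in-W v∈)) low-σv)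

    matching : MatchingBetween G (InU G) W (∣ W ∣ ∸ 1)
    matching = subst (MatchingBetween G (InU G) W) enough
      (matching-of-good (take k good-members)
        (Unique.take⁺ k (Unique.filter⁺ (λ w → InU? (σ w)) members-unique))
        (All.take⁺ k good-members-good))
      where
      k = ∣ W ∣ ∸ 1
      enough : length (take k good-members) ≡ k
      enough = trans (length-take k good-members) (m≤n⇒m⊓n≡m (∸-monoˡ-≤ 1 many-good-members))

proposition7p3 : (n : ℕ) (G : Graph n) → Connected G → ACis G 1 →
    (W : Subset n) → (∀ v → v ∈ W → ¬ InU G v) →
    MatchingBetween G (InU G) W (∣ W ∣ ∸ 1)
proposition7p3 n G _ ((((M , matching) ∷ []) , strategy , refl) , _) W W-low =
  CoveringInvolution.Construction.matching G (swapL G M)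
    (Swap.swap-involutive G M matching) (Swap.swap-along-edge G M matching)
    (one-round-covers G M matching strategy) W W-low
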